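{- Let $(S,\bullet)$ be an adequate partial semigroup. Then the closed invariant subsets of the PSPDS $(\beta S,\{\lambda_s\}_{s\in S})$ are precisely the closed left ideals of $\beta S$.
   Context: A partial semigroup is a nonempty set $S$ with a partially defined operation $\bullet$ such that $(x\bullet y)\bullet z=x\bullet(y\bullet z)$ in the sense that if either side is defined so is the other and they are equal. $R(x)=\{s:x\bullet s\text{ defined}\}$, $L(x)=\{s:s\bullet x\text{ defined}\}$; $S$ is adequate if $\bigcap_{s\in H}R(s)\ne\emptyset$ and $\bigcap_{s\in H}L(s)\ne\emptyset$ for all finite nonempty $H\subseteq S$. $\beta S$: ultrafilters on $S$, $\overline{A}=\{p:A\in p\}$; $s^{ -1}A=\{t\in R(s):s\bullet t\in A\}$; for $p\in\beta S$, $L(p)=\{s\in S:R(s)\in p\}$; for $p,q$ with $L(q)\in p$, $p\bullet q=\{A:\{s:s^{ -1}A\in q\}\in p\}$; $(\beta S,\bullet)$ is a partial semigroup. For $s\in S$, $\lambda_s:\overline{R(s)}\to\beta S$, $\lambda_s(p)=s\bullet p$. A subset $Y$ of $\beta S$ is invariant for this system if it is nonempty, closed, and $\lambda_s(p)\in Y$ whenever $p\in Y$ and $\lambda_s(p)$ is defined. A left ideal of $\beta S$ is a nonempty $I$ with $y\bullet x\in I$ whenever $x\in I$ and $y\bullet x$ is defined. -}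

module Defs where

open import Level using (Level; _⊔_) renaming (suc to lsuc; zero to lzero)
open import Data.Maybe using (Maybe; just; nothing; _>>=_)
open import Data.Product using (Σ; ∃; _×_; _,_)
open import Data.List using (List; _∷_)
open import Data.List.Relation.Unary.All using (All)
open import Data.Unit using (⊤; tt)
open import Data.Empty using (⊥)
open import Relation.Nullary using (¬_)
open import Relation.Binary.PropositionalEquality using (_≡_; refl)
open import Function.Bundles using (_⇔_)

-- A partial semigroup: a nonempty set S with a partial operation, encoded as
-- a total map into Maybe S (nothing = undefined).  Associativity in the sense
-- "if either side is defined so is the other and they are equal" is exactly
-- equality of the two Maybe-valued composites.
record PartialSemigroup : Set₁ where
  field
    Carrier  : Set
    _∙_      : Carrier → Carrier → Maybe Carrier
    nonempty : Carrier
    assoc    : ∀ x y z →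
               ((x ∙ y) >>= λ u → u ∙ z) ≡ ((y ∙ z) >>= λ v → x ∙ v)

module _ (PS : PartialSemigroup) where
  open PartialSemigroup PS renaming (Carrier to S)

  Pred : Set₁
  Pred = S → Set

  R : S → Pred
  R x s = ∃ λ t → x ∙ s ≡ just t

  L : S → Pred
  L x s = ∃ λ t → s ∙ x ≡ just t

  -- adequacy: for every finite nonempty H (given as a list x ∷ xs),
  -- ⋂_{s∈H} R(s) and ⋂_{s∈H} L(s) are nonempty.
  Adequate : Set
  Adequate = ∀ (x : S) (xs : List S) →
             (∃ λ t → All (λ s → R s t) (x ∷ xs)) ×
             (∃ λ t → All (λ s → L s t) (x ∷ xs))

  _⁻¹_ : S → Pred → Pred
  (s ⁻¹ A) t = ∃ λ u → (s ∙ t ≡ just u) × A u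

  record Ultrafilter : Set₁ where
    field
      _∋_      : Pred → Set
      full     : _∋_ (λ _ → ⊤)
      upward   : ∀ {A B : Pred} → _∋_ A → (∀ x → A x → B x) → _∋_ B
      inter    : ∀ {A B : Pred} → _∋_ A → _∋_ B → _∋_ (λ x → A x × B x)
      proper   : ∀ {A : Pred} → _∋_ A → ∃ λ x → A x
      ultra    : ∀ (A : Pred) → ¬ (_∋_ A) → _∋_ (λ x → ¬ A x)

  open Ultrafilter public

  Lβ : Ultrafilter → Pred
  Lβ p s = p ∋ R s

  -- The product in βS, as a relation:  IsProd p q r  means  L(q) ∈ p  and
  -- r = p ∙ q = { A : { s : s⁻¹A ∈ q } ∈ p }.
  IsProd : Ultrafilter → Ultrafilter → Ultrafilter → Set₁
  IsProd p q r = (p ∋ Lβ q) × (∀ (A : Pred) → (r ∋ A) ⇔ (p ∋ (λ s → q ∋ (s ⁻¹ A))))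

  principal : S → Ultrafilter
  principal s = record
    { _∋_ = λ A → A s
    ; full = tt
    ; upward = λ {A} {B} a f → f s a
    ; inter = λ a b → a , b
    ; proper = λ {A} a → s , a
    ; ultra = λ A na → na
    }

  module _ {ℓ : Level} (Y : Ultrafilter → Set ℓ) where
    -- topology of βS: p is in the closure of Y iff every basic
    -- neighbourhood Ā of p meets Y.  Y is closed iff it contains its closure.
    Closed : Set (lsuc lzero ⊔ ℓ)
    Closed = ∀ (p : Ultrafilter) →
             (∀ (A : Pred) → p ∋ A → ∃ λ q → Y q × (q ∋ A)) → Y p

    Nonempty : Set (lsuc lzero ⊔ ℓ)
    Nonempty = ∃ λ p → Y p

    -- invariant for the system (βS, {λ_s}_{s∈S}), λ_s(p) = s ∙ p defined on
    -- the closure of R(s)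
    Invariant : Set (lsuc lzero ⊔ ℓ)
    Invariant = Nonempty × Closed ×
                (∀ (s : S) (p r : Ultrafilter) → Y p →
                   p ∋ R s → IsProd (principal s) p r → Y r)

    LeftIdeal : Set (lsuc lzero ⊔ ℓ)
    LeftIdeal = Nonempty ×
                (∀ (p q r : Ultrafilter) → Y q → IsProd p q r → Y r)

{-# OPTIONS --safe #-}
-- For s ∈ S and q ∈ cl R(s), λ_s(q) is the product (principal s) • q, so every
-- closed left ideal is invariant.  Conversely, if A ∈ p • q then the set of
-- s ∈ L(q) with A ∈ s • q belongs to p and so is nonempty: p • q lies in the
-- closure of the translates s • q of q, and a closed invariant set containing
-- q therefore contains p • q.
module Submission where

open import Defs
open import Level using (Level; _⊔_) renaming (suc to lsuc; zero to lzero)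
open import Data.Product using (Σ; ∃; _×_; _,_)
open import Data.Maybe.Properties using (just-injective)
open import Data.Unit using (tt)
open import Relation.Nullary using (¬_)
open import Relation.Binary.PropositionalEquality using (trans; sym; subst)
open import Function.Base using (id)
open import Function.Bundles using (_⇔_; mk⇔; Equivalence)

module _ (PS : PartialSemigroup) where
  open PartialSemigroup PS renaming (Carrier to S)

  ClosedUnderTranslations : ∀ {ℓ} → (Ultrafilter PS → Set ℓ) → Set (lsuc lzero ⊔ ℓ)
  ClosedUnderTranslations Y = ∀ (s : S) (p r : Ultrafilter PS) →
                              Y p → p ∋ R PS s → IsProd PS (principal PS s) p r → Y r

  ⁻¹-∩ : ∀ {s A B} t → _⁻¹_ PS s A t → _⁻¹_ PS s B t → _⁻¹_ PS s (λ u → A u × B u) t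
  ⁻¹-∩ {B = B} t (u , st≡u , Au) (v , st≡v , Bv) =
    u , st≡u , Au , subst B (just-injective (trans (sym st≡v) st≡u)) Bv

  ⁻¹-complement : ∀ {s A} t → R PS s t → ¬ _⁻¹_ PS s A t → _⁻¹_ PS s (λ u → ¬ A u) t
  ⁻¹-complement t (u , st≡u) t∉s⁻¹A = u , st≡u , λ Au → t∉s⁻¹A (u , st≡u , Au)

  translate : (s : S) (q : Ultrafilter PS) → q ∋ R PS s → Ultrafilter PS
  translate s q q∋Rs = record
    { _∋_    = λ A → q ∋ _⁻¹_ PS s A
    ; full   = upward q q∋Rs (λ _ (u , st≡u) → u , st≡u , tt)
    ; upward = λ q∋s⁻¹A A⊆B →
        upward q q∋s⁻¹A (λ _ (u , st≡u , Au) → u , st≡u , A⊆B u Au)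
    ; inter  = λ q∋s⁻¹A q∋s⁻¹B →
        upward q (inter q q∋s⁻¹A q∋s⁻¹B) (λ t (t∈s⁻¹A , t∈s⁻¹B) → ⁻¹-∩ t t∈s⁻¹A t∈s⁻¹B)
    ; proper = λ q∋s⁻¹A → let (_ , u , _ , Au) = proper q q∋s⁻¹A in u , Au
    ; ultra  = λ A q∌s⁻¹A →
        upward q (inter q q∋Rs (ultra q (_⁻¹_ PS s A) q∌s⁻¹A))
               (λ t (t∈Rs , t∉s⁻¹A) → ⁻¹-complement t t∈Rs t∉s⁻¹A)
    }

  translate-isProd : ∀ s q (q∋Rs : q ∋ R PS s) →
                     IsProd PS (principal PS s) q (translate s q q∋Rs)
  translate-isProd _ _ q∋Rs = q∋Rs , λ _ → mk⇔ id id

  isProd-∋⇒translate-∋ : ∀ p q r {A} → IsProd PS p q r → r ∋ A →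
                         ∃ λ s → Σ (q ∋ R PS s) λ q∋Rs → translate s q q∋Rs ∋ A
  isProd-∋⇒translate-∋ p _ _ {A} (p∋Lq , r≡p•q) r∋A =
    proper p (inter p p∋Lq (Equivalence.to (r≡p•q A) r∋A))

  closed-translations⇒closed-products :
    ∀ {ℓ} {Y : Ultrafilter PS → Set ℓ} → Closed PS Y → ClosedUnderTranslations Y →
    ∀ p q r → Y q → IsProd PS p q r → Y r
  closed-translations⇒closed-products closed translations p q r Yq r≡p•q =
    closed r λ A r∋A →
      let (s , q∋Rs , s•q∋A) = isProd-∋⇒translate-∋ p q r r≡p•q r∋A
      in translate s q q∋Rs
       , translations s q _ Yq q∋Rs (translate-isProd s q q∋Rs)
       , s•q∋A

lemma3p11 : (PS : PartialSemigroup) → Adequate PS →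
            ∀ {ℓ : Level} (Y : Ultrafilter PS → Set ℓ) →
            Invariant PS Y ⇔ (Closed PS Y × LeftIdeal PS Y)
lemma3p11 PS _ Y = mk⇔ invariant⇒closedLeftIdeal closedLeftIdeal⇒invariant
  where
  invariant⇒closedLeftIdeal : Invariant PS Y → Closed PS Y × LeftIdeal PS Y
  invariant⇒closedLeftIdeal (nonempty , closed , translations) =
    closed , nonempty , closed-translations⇒closed-products PS closed translations

  closedLeftIdeal⇒invariant : Closed PS Y × LeftIdeal PS Y → Invariant PS Y
  closedLeftIdeal⇒invariant (closed , nonempty , products) =
    nonempty , closed , λ s p r Yp _ → products (principal PS s) p r Yp
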